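{- Let $b\geq 2$. If there exists a $k$-oasis base $b$, then \[k\leq \frac{b^3}{2}+\frac{b^2}{2}-b.\]
   Context: For integers $c\geq 0$ and $b\geq 2$, the augmented generalized happy function $S_{[c,b]}:\mathbb{Z}^+\to\mathbb{Z}^+$ is defined by $S_{[c,b]}\left(\sum_{i=0}^n a_i b^i\right)=c+\sum_{i=0}^n a_i^2$, where $0\le a_i\le b-1$, $a_n\neq 0$ (the base $b$ expansion). A positive integer $a$ is a fixed point of $S_{[c,b]}$ if $S_{[c,b]}(a)=a$. For $b\geq 2$ and $k\in\mathbb{Z}^+$, a $k$-oasis base $b$ is a set of $k$ consecutive non-negative integers $c$ such that for each of them $S_{[c,b]}$ has at least one fixed point. -}

module Defs where

open import Data.Nat using (ℕ; zero; suc; _+_; _*_; _^_; _<_; _≤_; NonZero)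
open import Data.Nat.DivMod using (_/_; _%_)
open import Data.Product using (Σ; _×_; ∃-syntax)
open import Relation.Binary.PropositionalEquality using (_≡_)

-- With fuel ≥ n and b ≥ 2 the fuel never runs out (n / b < n for n ≥ 1),
-- so digitSqSumFuel n b n is exactly Σ aᵢ² for n = Σ aᵢ bⁱ.
digitSqSumFuel : ℕ → (b : ℕ) → .{{NonZero b}} → ℕ → ℕ
digitSqSumFuel zero    b n       = zero
digitSqSumFuel (suc f) b zero    = zero
digitSqSumFuel (suc f) b (suc m) =
  let d = suc m % b in d * d + digitSqSumFuel f b (suc m / b)

digitSqSum : (b : ℕ) → .{{NonZero b}} → ℕ → ℕ
digitSqSum b n = digitSqSumFuel n b n

S : (c b : ℕ) → .{{NonZero b}} → ℕ → ℕ
S c b a = c + digitSqSum b a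

HasFixedPoint : (c b : ℕ) → .{{NonZero b}} → Set
HasFixedPoint c b = ∃[ a ] (1 ≤ a × S c b a ≡ a)

IsOasis : (k b : ℕ) → .{{NonZero b}} → Set
IsOasis k b = ∃[ c₀ ] (∀ i → i < k → HasFixedPoint (c₀ + i) b)

{-# OPTIONS --safe #-}
-- Write a fixed point a of S_[c,b] as a = Q·b³ + u + v·b + w·b² with digits u, v, w.
-- With D the digit-square sum, c + S(a) = a reads c + D(Q) + u² + v² + w² = Q·b³ + u + v·b + w·b²;
-- the low digits move the difference of the two sides only within [−Δ⁻, Δ⁺], so c lies in
-- a window around Q·b³ − D(Q).  As D grows by at most δ = 2b − 3 per step, Q·b³ − D(Q)
-- grows by at least b³ − δ = Δ⁺ + Δ⁻ + 2 from one Q to the next, so consecutive windows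
-- leave a value of c without fixed points and all fixed points along an oasis share Q.
-- For fixed Q, c is then determined by u² − u, v² − v·b and w, which take at most b − 1,
-- ⌊b/2⌋ + 1 and b values; hence k ≤ b (b − 1) (⌊b/2⌋ + 1) ≤ (b³ + b² − 2b)/2.
module Submission where

open import Defs
open import Data.Nat
open import Data.Nat.Properties
open import Data.Nat.DivMod
open import Data.Nat.Divisibility using (divides)
open import Data.Nat.Induction using (<-rec)
open import Data.Nat.Tactic.RingSolver using (solve-∀)
open import Data.Fin using (Fin; toℕ; fromℕ<; combine)
open import Data.Fin.Properties using (injective⇒≤; combine-injective; fromℕ<-injective; toℕ-injective; toℕ<n)
open import Data.Product using (_×_; _,_; proj₁; proj₂)
open import Data.Empty using (⊥-elim)
open import Data.Sum using (inj₁; inj₂)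
open import Function.Definitions using (Injective)
open import Relation.Binary.Definitions using (tri<; tri≈; tri>)
open import Relation.Binary.PropositionalEquality
open import Relation.Nullary using (yes; no)

module _ (n : ℕ) where

  b : ℕ
  b = 2 + n

  D : ℕ → ℕ
  D = digitSqSum b

  1+m/b≤m : ∀ m → suc m / b ≤ m
  1+m/b≤m m = s≤s⁻¹ (m/n<m (suc m) b (s≤s (s≤s z≤n)))

  digitSqSumFuel-irrelevant : ∀ f g m → m ≤ f → m ≤ g →
                              digitSqSumFuel f b m ≡ digitSqSumFuel g b m
  digitSqSumFuel-irrelevant zero    zero    zero    _         _         = refl
  digitSqSumFuel-irrelevant zero    (suc g) zero    _         _         = refl
  digitSqSumFuel-irrelevant (suc f) zero    zero    _         _         = refl
  digitSqSumFuel-irrelevant (suc f) (suc g) zero    _         _         = refl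
  digitSqSumFuel-irrelevant (suc f) (suc g) (suc m) (s≤s m≤f) (s≤s m≤g) =
    cong (suc m % b * (suc m % b) +_)
         (digitSqSumFuel-irrelevant f g (suc m / b) (≤-trans (1+m/b≤m m) m≤f) (≤-trans (1+m/b≤m m) m≤g))

  D-step : ∀ m → D m ≡ m % b * (m % b) + D (m / b)
  D-step zero    = refl
  D-step (suc m) = cong (suc m % b * (suc m % b) +_)
    (digitSqSumFuel-irrelevant m (suc m / b) (suc m / b) (1+m/b≤m m) ≤-refl)

  D-digit : ∀ r p → r < b → D (r + p * b) ≡ r * r + D p
  D-digit r p r<b = begin
    D (r + p * b)                                              ≡⟨ D-step (r + p * b) ⟩
    (r + p * b) % b * ((r + p * b) % b) + D ((r + p * b) / b)  ≡⟨ cong₂ (λ u v → u * u + D v) last rest ⟩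
    r * r + D p                                                ∎
    where
    open ≡-Reasoning
    last : (r + p * b) % b ≡ r
    last = trans ([m+kn]%n≡m%n r p b) (m<n⇒m%n≡m r<b)
    rest : (r + p * b) / b ≡ p
    rest = begin
      (r + p * b) / b   ≡⟨ +-distrib-/-∣ʳ r (divides p refl) ⟩
      r / b + p * b / b ≡⟨ cong₂ _+_ (m<n⇒m/n≡0 r<b) (m*n/n≡m p b) ⟩
      p                 ∎

  δ : ℕ
  δ = suc (n + n)

  D-suc-digit : ∀ r p → r < b → (p < r + p * b → D (suc p) ≤ D p + δ) →
                D (suc (r + p * b)) ≤ D (r + p * b) + δ
  D-suc-digit r p r<b rec with m≤n⇒m<n∨m≡n (s≤s⁻¹ r<b)
  ... | inj₁ (s≤s r≤n) = begin
    D (suc r + p * b)           ≡⟨ D-digit (suc r) p (s≤s (s≤s r≤n)) ⟩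
    suc r * suc r + D p         ≡⟨ square-suc r (D p) ⟩
    r * r + D p + suc (r + r)   ≤⟨ +-monoʳ-≤ (r * r + D p) (s≤s (+-mono-≤ r≤n r≤n)) ⟩
    r * r + D p + δ             ≡⟨ cong (_+ δ) (D-digit r p r<b) ⟨
    D (r + p * b) + δ           ∎
    where
    open ≤-Reasoning
    square-suc : ∀ r d → suc r * suc r + d ≡ r * r + d + suc (r + r)
    square-suc = solve-∀
  ... | inj₂ refl = begin
    D (0 + suc p * b)           ≡⟨ D-digit 0 (suc p) (s≤s z≤n) ⟩
    D (suc p)                   ≤⟨ rec (s≤s (≤-trans (m≤m*n p b) (m≤n+m (p * b) n))) ⟩
    D p + δ                     ≤⟨ +-monoˡ-≤ δ (m≤n+m (D p) (suc n * suc n)) ⟩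
    suc n * suc n + D p + δ     ≡⟨ cong (_+ δ) (D-digit (suc n) p r<b) ⟨
    D (suc n + p * b) + δ       ∎
    where open ≤-Reasoning

  D-suc : ∀ q → D (suc q) ≤ D q + δ
  D-suc = <-rec (λ q → D (suc q) ≤ D q + δ) λ q rec →
    subst (λ x → D (suc x) ≤ D x + δ) (sym (split q))
      (D-suc-digit (q % b) (q / b) (m%n<n q b) (λ lt → rec (subst (q / b <_) (sym (split q)) lt)))
    where
    split : ∀ q → q ≡ q % b + q / b * b
    split q = m≡m%n+[m/n]*n q b

  b³ : ℕ
  b³ = b * (b * b)

  Δ₁ Δ₂ Δ⁺ Δ⁻ : ℕ
  Δ₁ = suc n * b
  Δ₂ = suc n * (suc n * suc n + suc n + 1)
  Δ⁺ = Δ₁ + Δ₂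
  Δ⁻ = suc n * n

  Δ : ℕ
  Δ = Δ⁺ + Δ⁻ + δ

  2+Δ≡b³ : 2 + Δ ≡ b³
  2+Δ≡b³ = expand n
    where
    expand : ∀ n → 2 + (suc n * (2 + n) + suc n * (suc n * suc n + suc n + 1) + suc n * n + suc (n + n))
                   ≡ (2 + n) * ((2 + n) * (2 + n))
    expand = solve-∀

  Δ<b³ : Δ < b³
  Δ<b³ = ≤-trans (n≤1+n (suc Δ)) (≤-reflexive 2+Δ≡b³)

  δ≤b³ : δ ≤ b³
  δ≤b³ = ≤-trans (m≤n+m δ (Δ⁺ + Δ⁻)) (<⇒≤ Δ<b³)

  D-+ : ∀ q t → D (q + t) ≤ D q + t * δ
  D-+ q zero    = ≤-reflexive (trans (cong D (+-identityʳ q)) (sym (+-identityʳ (D q))))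
  D-+ q (suc t) = begin
    D (q + suc t)         ≡⟨ cong D (+-suc q t) ⟩
    D (suc (q + t))       ≤⟨ D-suc (q + t) ⟩
    D (q + t) + δ         ≤⟨ +-monoˡ-≤ δ (D-+ q t) ⟩
    D q + t * δ + δ       ≡⟨ rearrange (D q) (t * δ) δ ⟩
    D q + suc t * δ       ∎
    where
    open ≤-Reasoning
    rearrange : ∀ d x y → d + x + y ≡ d + (y + x)
    rearrange = solve-∀

  quotient-mono : ∀ {Q Q'} → Q ≤ Q' → Q * b³ + D Q' ≤ Q' * b³ + D Q
  quotient-mono {Q} Q≤Q' with m≤n⇒∃[o]m+o≡n Q≤Q'
  ... | t , refl = begin
    Q * b³ + D (Q + t)         ≤⟨ +-monoʳ-≤ (Q * b³) (D-+ Q t) ⟩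
    Q * b³ + (D Q + t * δ)     ≤⟨ +-monoʳ-≤ (Q * b³) (+-monoʳ-≤ (D Q) (*-monoʳ-≤ t δ≤b³)) ⟩
    Q * b³ + (D Q + t * b³)    ≡⟨ rearrange Q t b³ (D Q) ⟩
    (Q + t) * b³ + D Q         ∎
    where
    open ≤-Reasoning
    rearrange : ∀ Q t B d → Q * B + (d + t * B) ≡ (Q + t) * B + d
    rearrange = solve-∀

  quotient-gap : ∀ {Q Q'} → Q < Q' → Q * b³ + b³ + D Q' ≤ Q' * b³ + D Q + δ
  quotient-gap {Q} {suc Q'} (s≤s Q≤Q') = begin
    Q * b³ + b³ + D (suc Q')       ≤⟨ +-monoʳ-≤ (Q * b³ + b³) (D-suc Q') ⟩
    Q * b³ + b³ + (D Q' + δ)       ≡⟨ rearrange (Q * b³) b³ (D Q') δ ⟩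
    Q * b³ + D Q' + (b³ + δ)       ≤⟨ +-monoˡ-≤ (b³ + δ) (quotient-mono Q≤Q') ⟩
    Q' * b³ + D Q + (b³ + δ)       ≡⟨ rearrange′ (Q' * b³) (D Q) b³ δ ⟩
    suc Q' * b³ + D Q + δ          ∎
    where
    open ≤-Reasoning
    rearrange : ∀ x B d e → x + B + (d + e) ≡ x + d + (B + e)
    rearrange = solve-∀
    rearrange′ : ∀ x d B e → x + d + (B + e) ≡ B + x + d + e
    rearrange′ = solve-∀

  d₀ d₁ d₂ quot : ℕ → ℕ
  d₀ a   = a % b
  d₁ a   = a / b % b
  d₂ a   = a / b / b % b
  quot a = a / b / b / b

  value sqSum : ℕ → ℕ → ℕ → ℕ
  value u v w = u + v * b + w * (b * b)
  sqSum u v w = u * u + v * v + w * w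

  Signature : Set
  Signature = ℕ × ℕ × ℕ × ℕ

  digits : ℕ → Signature
  digits a = quot a , d₀ a , d₁ a , d₂ a

  FixedPointEq : ℕ → Signature → Set
  FixedPointEq c (Q , u , v , w) = c + D Q + sqSum u v w ≡ Q * b³ + value u v w

  value-digits : ∀ a → a ≡ quot a * b³ + value (d₀ a) (d₁ a) (d₂ a)
  value-digits a = begin
    a                                           ≡⟨ m≡m%n+[m/n]*n a b ⟩
    d₀ a + a / b * b                            ≡⟨ cong (λ z → d₀ a + z * b) (m≡m%n+[m/n]*n (a / b) b) ⟩
    d₀ a + (d₁ a + a / b / b * b) * b           ≡⟨ cong (λ z → d₀ a + (d₁ a + z * b) * b) (m≡m%n+[m/n]*n (a / b / b) b) ⟩
    d₀ a + (d₁ a + (d₂ a + quot a * b) * b) * b ≡⟨ horner (d₀ a) (d₁ a) (d₂ a) (quot a) b ⟩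
    quot a * b³ + value (d₀ a) (d₁ a) (d₂ a)    ∎
    where
    open ≡-Reasoning
    horner : ∀ u v w q b → u + (v + (w + q * b) * b) * b ≡ q * (b * (b * b)) + (u + v * b + w * (b * b))
    horner = solve-∀

  D-digits : ∀ a → D a ≡ D (quot a) + sqSum (d₀ a) (d₁ a) (d₂ a)
  D-digits a = begin
    D a                                                    ≡⟨ D-step a ⟩
    d₀ a * d₀ a + D (a / b)                                ≡⟨ cong (d₀ a * d₀ a +_) (D-step (a / b)) ⟩
    d₀ a * d₀ a + (d₁ a * d₁ a + D (a / b / b))            ≡⟨ cong (λ z → d₀ a * d₀ a + (d₁ a * d₁ a + z)) (D-step (a / b / b)) ⟩
    d₀ a * d₀ a + (d₁ a * d₁ a + (d₂ a * d₂ a + D (quot a))) ≡⟨ rearrange (d₀ a * d₀ a) (d₁ a * d₁ a) (d₂ a * d₂ a) (D (quot a)) ⟩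
    D (quot a) + sqSum (d₀ a) (d₁ a) (d₂ a)                ∎
    where
    open ≡-Reasoning
    rearrange : ∀ u v w d → u + (v + (w + d)) ≡ d + (u + v + w)
    rearrange = solve-∀

  fixedPoint-digits : ∀ {c a} → S c b a ≡ a → FixedPointEq c (digits a)
  fixedPoint-digits {c} {a} fp = begin
    c + D (quot a) + sqSum (d₀ a) (d₁ a) (d₂ a)    ≡⟨ +-assoc c _ _ ⟩
    c + (D (quot a) + sqSum (d₀ a) (d₁ a) (d₂ a))  ≡⟨ cong (c +_) (D-digits a) ⟨
    c + D a                                        ≡⟨ fp ⟩
    a                                              ≡⟨ value-digits a ⟩
    quot a * b³ + value (d₀ a) (d₁ a) (d₂ a)       ∎
    where open ≡-Reasoning

  d₀<b : ∀ a → d₀ a < b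
  d₀<b a = m%n<n a b

  d₁<b : ∀ a → d₁ a < b
  d₁<b a = m%n<n (a / b) b

  d₂<b : ∀ a → d₂ a < b
  d₂<b a = m%n<n (a / b / b) b

  x≤x*x : ∀ x → x ≤ x * x
  x≤x*x zero    = z≤n
  x≤x*x (suc x) = s≤s (m≤m+n x _)

  x*b≤x*x+Δ₁ : ∀ {x} → x < b → x * b ≤ x * x + Δ₁
  x*b≤x*x+Δ₁ {x} x<b = ≤-trans (*-monoˡ-≤ b (s≤s⁻¹ x<b)) (m≤n+m Δ₁ (x * x))

  x*b²≤x*x+Δ₂ : ∀ {x} → x < b → x * (b * b) ≤ x * x + Δ₂
  x*b²≤x*x+Δ₂ {x} x<b = subst (λ m → x * (suc m * suc m) ≤ x * x + m * (m * m + m + 1))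
    (m+[n∸m]≡n (s≤s⁻¹ x<b)) (bound x (suc n ∸ x))
    where
    expand : ∀ x y → x * (suc (x + y) * suc (x + y)) + y * ((x + y) * (x + y) + 1 + y)
                     ≡ x * x + (x + y) * ((x + y) * (x + y) + (x + y) + 1)
    expand = solve-∀
    bound : ∀ x y → x * (suc (x + y) * suc (x + y)) ≤ x * x + (x + y) * ((x + y) * (x + y) + (x + y) + 1)
    bound x y = ≤-trans (m≤m+n _ _) (≤-reflexive (expand x y))

  x*x≤x+Δ⁻ : ∀ {x} → x < b → x * x ≤ x + Δ⁻
  x*x≤x+Δ⁻ {zero}  _           = z≤n
  x*x≤x+Δ⁻ {suc x} (s≤s x<sn) =
    +-monoʳ-≤ (suc x) (≤-trans (*-mono-≤ (s≤s⁻¹ x<sn) x<sn) (≤-reflexive (*-comm n (suc n))))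

  x*x≤x*b : ∀ {x} → x < b → x * x ≤ x * b
  x*x≤x*b {x} x<b = *-monoʳ-≤ x (<⇒≤ x<b)

  x*x≤x*b² : ∀ {x} → x < b → x * x ≤ x * (b * b)
  x*x≤x*b² {x} x<b = *-monoʳ-≤ x (≤-trans (<⇒≤ x<b) (m≤m*n b b))

  value≤sqSum+Δ⁺ : ∀ {u v w} → v < b → w < b → value u v w ≤ sqSum u v w + Δ⁺
  value≤sqSum+Δ⁺ {u} {v} {w} v<b w<b =
    ≤-trans (+-mono-≤ (+-mono-≤ (x≤x*x u) (x*b≤x*x+Δ₁ v<b)) (x*b²≤x*x+Δ₂ w<b))
            (≤-reflexive (rearrange (u * u) (v * v) (w * w) Δ₁ Δ₂))
    where
    rearrange : ∀ u v w p q → u + (v + p) + (w + q) ≡ u + v + w + (p + q)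
    rearrange = solve-∀

  sqSum≤value+Δ⁻ : ∀ {u v w} → u < b → v < b → w < b → sqSum u v w ≤ value u v w + Δ⁻
  sqSum≤value+Δ⁻ {u} {v} {w} u<b v<b w<b =
    ≤-trans (+-mono-≤ (+-mono-≤ (x*x≤x+Δ⁻ u<b) (x*x≤x*b v<b)) (x*x≤x*b² w<b))
            (≤-reflexive (rearrange u (v * b) (w * (b * b)) Δ⁻))
    where
    rearrange : ∀ u v w l → u + l + v + w ≡ u + v + w + l
    rearrange = solve-∀

  fixedPoint-upper : ∀ {c a} → S c b a ≡ a → c + D (quot a) ≤ quot a * b³ + Δ⁺
  fixedPoint-upper {c} {a} fp = +-cancelʳ-≤ (sqSum (d₀ a) (d₁ a) (d₂ a)) _ _ (begin
    c + D (quot a) + sqSum (d₀ a) (d₁ a) (d₂ a)         ≡⟨ fixedPoint-digits fp ⟩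
    quot a * b³ + value (d₀ a) (d₁ a) (d₂ a)            ≤⟨ +-monoʳ-≤ (quot a * b³) (value≤sqSum+Δ⁺ (d₁<b a) (d₂<b a)) ⟩
    quot a * b³ + (sqSum (d₀ a) (d₁ a) (d₂ a) + Δ⁺)     ≡⟨ rearrange (quot a * b³) _ Δ⁺ ⟩
    quot a * b³ + Δ⁺ + sqSum (d₀ a) (d₁ a) (d₂ a)       ∎)
    where
    open ≤-Reasoning
    rearrange : ∀ x y z → x + (y + z) ≡ x + z + y
    rearrange = solve-∀

  fixedPoint-lower : ∀ {c a} → S c b a ≡ a → quot a * b³ ≤ c + D (quot a) + Δ⁻
  fixedPoint-lower {c} {a} fp = +-cancelʳ-≤ (value (d₀ a) (d₁ a) (d₂ a)) _ _ (begin
    quot a * b³ + value (d₀ a) (d₁ a) (d₂ a)            ≡⟨ fixedPoint-digits fp ⟨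
    c + D (quot a) + sqSum (d₀ a) (d₁ a) (d₂ a)         ≤⟨ +-monoʳ-≤ (c + D (quot a)) (sqSum≤value+Δ⁻ (d₀<b a) (d₁<b a) (d₂<b a)) ⟩
    c + D (quot a) + (value (d₀ a) (d₁ a) (d₂ a) + Δ⁻)  ≡⟨ rearrange (c + D (quot a)) _ Δ⁻ ⟩
    c + D (quot a) + Δ⁻ + value (d₀ a) (d₁ a) (d₂ a)    ∎)
    where
    open ≤-Reasoning
    rearrange : ∀ x y z → x + (y + z) ≡ x + z + y
    rearrange = solve-∀

  fixedPoint-quot-mono : ∀ {c c' a a'} → c ≤ c' → S c b a ≡ a → S c' b a' ≡ a' → quot a ≤ quot a'
  fixedPoint-quot-mono {c} {c'} {a} {a'} c≤c' fp fp' = ≮⇒≥ λ Q'<Q →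
    <⇒≱ Δ<b³ (+-cancelˡ-≤ (Q' * b³ + D Q) _ _ (begin
      Q' * b³ + D Q + b³          ≡⟨ swap (Q' * b³) (D Q) b³ ⟩
      Q' * b³ + b³ + D Q          ≤⟨ quotient-gap Q'<Q ⟩
      Q * b³ + D Q' + δ           ≤⟨ +-monoˡ-≤ δ (+-monoˡ-≤ (D Q') (fixedPoint-lower fp)) ⟩
      c + D Q + Δ⁻ + D Q' + δ     ≤⟨ +-monoˡ-≤ δ (+-monoˡ-≤ (D Q') (+-monoˡ-≤ Δ⁻ (+-monoˡ-≤ (D Q) c≤c'))) ⟩
      c' + D Q + Δ⁻ + D Q' + δ    ≡⟨ regroup c' (D Q) Δ⁻ (D Q') δ ⟩
      c' + D Q' + (D Q + Δ⁻ + δ)  ≤⟨ +-monoˡ-≤ (D Q + Δ⁻ + δ) (fixedPoint-upper fp') ⟩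
      Q' * b³ + Δ⁺ + (D Q + Δ⁻ + δ) ≡⟨ regroup′ (Q' * b³) Δ⁺ (D Q) Δ⁻ δ ⟩
      Q' * b³ + D Q + Δ           ∎))
    where
    open ≤-Reasoning
    Q Q' : ℕ
    Q  = quot a
    Q' = quot a'
    swap : ∀ x y z → x + y + z ≡ x + z + y
    swap = solve-∀
    regroup : ∀ c d l d' e → c + d + l + d' + e ≡ c + d' + (d + l + e)
    regroup = solve-∀
    regroup′ : ∀ q p d l e → q + p + (d + l + e) ≡ q + d + (p + l + e)
    regroup′ = solve-∀

  fixedPoint-beyond-gap : ∀ {c* Q c a} → c* + D Q ≡ Q * b³ + Δ⁺ + 1 → S c b a ≡ a → Q < quot a → c* < c
  fixedPoint-beyond-gap {c*} {Q} {c} {a} gap fp Q<Q' = +-cancelʳ-≤ (D Q + D Q' + suc Δ) _ _ (begin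
    suc c* + (D Q + D Q' + suc Δ)               ≡⟨ regroup c* (D Q) (D Q') Δ ⟩
    c* + D Q + (2 + Δ) + D Q'                   ≡⟨ cong₂ (λ x y → x + y + D Q') gap 2+Δ≡b³ ⟩
    Q * b³ + Δ⁺ + 1 + b³ + D Q'                 ≡⟨ regroup′ (Q * b³) Δ⁺ b³ (D Q') ⟩
    Q * b³ + b³ + D Q' + (Δ⁺ + 1)               ≤⟨ +-monoˡ-≤ (Δ⁺ + 1) (quotient-gap Q<Q') ⟩
    Q' * b³ + D Q + δ + (Δ⁺ + 1)                ≤⟨ +-monoˡ-≤ (Δ⁺ + 1) (+-monoˡ-≤ δ (+-monoˡ-≤ (D Q) (fixedPoint-lower fp))) ⟩
    c + D Q' + Δ⁻ + D Q + δ + (Δ⁺ + 1)          ≡⟨ regroup″ c (D Q') Δ⁻ (D Q) δ Δ⁺ ⟩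
    c + (D Q + D Q' + suc Δ)                    ∎)
    where
    open ≤-Reasoning
    Q' : ℕ
    Q' = quot a
    regroup : ∀ c d d' x → suc c + (d + d' + suc x) ≡ c + d + (2 + x) + d'
    regroup = solve-∀
    regroup′ : ∀ q p B d → q + p + 1 + B + d ≡ q + B + d + (p + 1)
    regroup′ = solve-∀
    regroup″ : ∀ c d' l d e p → c + d' + l + d + e + (p + 1) ≡ c + (d + d' + suc (p + l + e))
    regroup″ = solve-∀

  noFixedPoint-in-gap : ∀ {c* Q a} → c* + D Q ≡ Q * b³ + Δ⁺ + 1 → S c* b a ≢ a
  noFixedPoint-in-gap {c*} {Q} {a} gap fp with Q <? quot a
  ... | yes Q<Q' = <-irrefl refl (fixedPoint-beyond-gap gap fp Q<Q')
  ... | no  Q≮Q' = <-irrefl refl (begin-strict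
    Q * b³ + Δ⁺ + D Q'          <⟨ m<m+n _ z<s ⟩
    Q * b³ + Δ⁺ + D Q' + 1      ≡⟨ swap (Q * b³ + Δ⁺) (D Q') 1 ⟩
    Q * b³ + Δ⁺ + 1 + D Q'      ≡⟨ cong (_+ D Q') gap ⟨
    c* + D Q + D Q'             ≡⟨ swap c* (D Q) (D Q') ⟩
    c* + D Q' + D Q             ≤⟨ +-monoˡ-≤ (D Q) (fixedPoint-upper fp) ⟩
    Q' * b³ + Δ⁺ + D Q          ≡⟨ swap (Q' * b³) Δ⁺ (D Q) ⟩
    Q' * b³ + D Q + Δ⁺          ≤⟨ +-monoˡ-≤ Δ⁺ (quotient-mono (≮⇒≥ Q≮Q')) ⟩
    Q * b³ + D Q' + Δ⁺          ≡⟨ swap (Q * b³) (D Q') Δ⁺ ⟩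
    Q * b³ + Δ⁺ + D Q'          ∎)
    where
    open ≤-Reasoning
    Q' : ℕ
    Q' = quot a
    swap : ∀ x y z → x + y + z ≡ x + z + y
    swap = solve-∀

  fixedPointEq-injective : ∀ {c c'} σ → FixedPointEq c σ → FixedPointEq c' σ → c ≡ c'
  fixedPointEq-injective (Q , u , v , w) eq eq' =
    +-cancelʳ-≡ (D Q) _ _ (+-cancelʳ-≡ (sqSum u v w) _ _ (trans eq (sym eq')))

  fixedPointEq-exchange : ∀ {c Q u v w} u' v' →
                          u + u' * u' ≡ u' + u * u → v * b + v' * v' ≡ v' * b + v * v →
                          FixedPointEq c (Q , u , v , w) → FixedPointEq c (Q , u' , v' , w)
  fixedPointEq-exchange {c} {Q} {u} {v} {w} u' v' eu ev eq =
    +-cancelʳ-≡ (u * u + v * v) _ _ (begin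
      c + D Q + sqSum u' v' w + (u * u + v * v)                      ≡⟨ regroup (c + D Q) (u * u) (v * v) (w * w) (u' * u') (v' * v') ⟩
      c + D Q + sqSum u v w + (u' * u' + v' * v')                    ≡⟨ cong (_+ (u' * u' + v' * v')) eq ⟩
      Q * b³ + value u v w + (u' * u' + v' * v')                     ≡⟨ regroup′ (Q * b³) u (v * b) (w * (b * b)) (u' * u') (v' * v') ⟩
      Q * b³ + (u + u' * u') + (v * b + v' * v') + w * (b * b)       ≡⟨ cong₂ (λ x y → Q * b³ + x + y + w * (b * b)) eu ev ⟩
      Q * b³ + (u' + u * u) + (v' * b + v * v) + w * (b * b)         ≡⟨ regroup″ (Q * b³) u' (u * u) (v' * b) (v * v) (w * (b * b)) ⟩
      Q * b³ + value u' v' w + (u * u + v * v)                       ∎)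
    where
    open ≡-Reasoning
    regroup : ∀ p s t r s' t' → p + (s' + t' + r) + (s + t) ≡ p + (s + t + r) + (s' + t')
    regroup = solve-∀
    regroup′ : ∀ q u v w s t → q + (u + v + w) + (s + t) ≡ q + (u + s) + (v + t) + w
    regroup′ = solve-∀
    regroup″ : ∀ q u' uu v' vv w → q + (u' + uu) + (v' + vv) + w ≡ q + (u' + v' + w) + (uu + vv)
    regroup″ = solve-∀

  fold₀ fold₁ : ℕ → ℕ
  fold₀ u = suc (pred u)
  fold₁ v = v ⊓ (b ∸ v)

  fold₀-exchange : ∀ u → u + fold₀ u * fold₀ u ≡ fold₀ u + u * u
  fold₀-exchange zero    = refl
  fold₀-exchange (suc u) = refl

  fold₁-exchange : ∀ {v} → v ≤ b → v * b + fold₁ v * fold₁ v ≡ fold₁ v * b + v * v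
  fold₁-exchange {v} v≤b with ⊓-sel v (b ∸ v)
  ... | inj₁ fold≡v  = subst (λ h → v * b + h * h ≡ h * b + v * v) (sym fold≡v) refl
  ... | inj₂ fold≡b∸v = subst (λ h → v * b + h * h ≡ h * b + v * v) (sym fold≡b∸v)
    (subst (λ m → v * m + (b ∸ v) * (b ∸ v) ≡ (b ∸ v) * m + v * v) (m+[n∸m]≡n v≤b) (symmetric v (b ∸ v)))
    where
    symmetric : ∀ v y → v * (v + y) + y * y ≡ y * (v + y) + v * v
    symmetric = solve-∀

  folded : ℕ → Signature
  folded a = quot a , fold₀ (d₀ a) , fold₁ (d₁ a) , d₂ a

  fixedPoint-folded : ∀ {c a} → S c b a ≡ a → FixedPointEq c (folded a)
  fixedPoint-folded {a = a} fp =
    fixedPointEq-exchange {Q = quot a} {d₀ a} {d₁ a} {d₂ a} (fold₀ (d₀ a)) (fold₁ (d₁ a))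
      (fold₀-exchange (d₀ a)) (fold₁-exchange (<⇒≤ (d₁<b a))) (fixedPoint-digits fp)

  pred-d₀≤n : ∀ a → pred (d₀ a) ≤ n
  pred-d₀≤n a = pred-mono-≤ (s≤s⁻¹ (d₀<b a))

  fold₁-d₁≤⌊b/2⌋ : ∀ a → fold₁ (d₁ a) ≤ ⌊ b /2⌋
  fold₁-d₁≤⌊b/2⌋ a = subst (_≤ ⌊ b /2⌋) (sym (n≡⌊n+n/2⌋ h)) (⌊n/2⌋-mono h+h≤b)
    where
    h : ℕ
    h = fold₁ (d₁ a)
    h+h≤b : h + h ≤ b
    h+h≤b = ≤-trans (+-mono-≤ (m⊓n≤m (d₁ a) (b ∸ d₁ a)) (m⊓n≤n (d₁ a) (b ∸ d₁ a)))
                    (≤-reflexive (m+[n∸m]≡n (<⇒≤ (d₁<b a))))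

  codeSize : ℕ
  codeSize = b * (suc ⌊ b /2⌋ * suc n)

  code : ℕ → Fin codeSize
  code a = combine (fromℕ< (d₂<b a)) (combine (fromℕ< (s≤s (fold₁-d₁≤⌊b/2⌋ a))) (fromℕ< (s≤s (pred-d₀≤n a))))

  code-injective : ∀ a a' → quot a ≡ quot a' → code a ≡ code a' → folded a ≡ folded a'
  code-injective a a' eQ eq with combine-injective _ _ _ _ eq
  ... | e₂ , eq′ with combine-injective _ _ _ _ eq′
  ... | e₁ , e₀ = cong₂ _,_ eQ (cong₂ _,_ (cong suc (fromℕ<-injective _ _ (s≤s (pred-d₀≤n a)) (s≤s (pred-d₀≤n a')) e₀))
                                (cong₂ _,_ (fromℕ<-injective _ _ (s≤s (fold₁-d₁≤⌊b/2⌋ a)) (s≤s (fold₁-d₁≤⌊b/2⌋ a')) e₁)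
                                           (fromℕ<-injective _ _ (d₂<b a) (d₂<b a') e₂)))

  module Oasis {c₀ k : ℕ} (fps : ∀ i → i < k → HasFixedPoint (c₀ + i) b) (0<k : 0 < k) where

    fixedPoint : ∀ i → i < k → ℕ
    fixedPoint i i<k = proj₁ (fps i i<k)

    isFixed : ∀ i (i<k : i < k) → S (c₀ + i) b (fixedPoint i i<k) ≡ fixedPoint i i<k
    isFixed i i<k = proj₂ (proj₂ (fps i i<k))

    Q₀ : ℕ
    Q₀ = quot (fixedPoint 0 0<k)

    isFixed₀ : S c₀ b (fixedPoint 0 0<k) ≡ fixedPoint 0 0<k
    isFixed₀ = subst (λ c → S c b (fixedPoint 0 0<k) ≡ fixedPoint 0 0<k) (+-identityʳ c₀) (isFixed 0 0<k)

    gapOffset : ℕ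
    gapOffset = Q₀ * b³ + Δ⁺ + 1 ∸ (c₀ + D Q₀)

    gapOffset-gap : c₀ + gapOffset + D Q₀ ≡ Q₀ * b³ + Δ⁺ + 1
    gapOffset-gap = begin
      c₀ + gapOffset + D Q₀   ≡⟨ swap c₀ gapOffset (D Q₀) ⟩
      c₀ + D Q₀ + gapOffset   ≡⟨ m+[n∸m]≡n (m≤n⇒m≤n+o 1 (fixedPoint-upper isFixed₀)) ⟩
      Q₀ * b³ + Δ⁺ + 1        ∎
      where
      open ≡-Reasoning
      swap : ∀ x y z → x + y + z ≡ x + z + y
      swap = solve-∀

    quot-constant : ∀ i (i<k : i < k) → quot (fixedPoint i i<k) ≡ Q₀
    quot-constant i i<k with <-cmp (quot (fixedPoint i i<k)) Q₀
    ... | tri< Q<Q₀ _ _ = ⊥-elim (<⇒≱ Q<Q₀ (fixedPoint-quot-mono (m≤m+n c₀ i) isFixed₀ (isFixed i i<k)))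
    ... | tri≈ _ Q≡Q₀ _ = Q≡Q₀
    ... | tri> _ _ Q₀<Q = ⊥-elim (noFixedPoint-in-gap {Q = Q₀} gapOffset-gap (isFixed gapOffset gapOffset<k))
      where
      gapOffset<k : gapOffset < k
      gapOffset<k = <-trans (+-cancelˡ-< c₀ _ _ (fixedPoint-beyond-gap {Q = Q₀} gapOffset-gap (isFixed i i<k) Q₀<Q)) i<k

    oasisCode : Fin k → Fin codeSize
    oasisCode i = code (fixedPoint (toℕ i) (toℕ<n i))

    oasisCode-injective : Injective _≡_ _≡_ oasisCode
    oasisCode-injective {i} {j} eq = toℕ-injective (+-cancelˡ-≡ c₀ _ _
      (fixedPointEq-injective (folded aᵢ) (fixedPoint-folded (isFixed (toℕ i) (toℕ<n i)))
        (subst (FixedPointEq (c₀ + toℕ j)) (sym same) (fixedPoint-folded (isFixed (toℕ j) (toℕ<n j))))))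
      where
      aᵢ aⱼ : ℕ
      aᵢ = fixedPoint (toℕ i) (toℕ<n i)
      aⱼ = fixedPoint (toℕ j) (toℕ<n j)
      same : folded aᵢ ≡ folded aⱼ
      same = code-injective aᵢ aⱼ (trans (quot-constant (toℕ i) (toℕ<n i)) (sym (quot-constant (toℕ j) (toℕ<n j)))) eq

    k≤codeSize : k ≤ codeSize
    k≤codeSize = injective⇒≤ oasisCode-injective

  2*codeSize+2*b≤b³+b² : 2 * codeSize + 2 * b ≤ b ^ 3 + b ^ 2
  2*codeSize+2*b≤b³+b² = begin
    2 * (b * (suc h * suc n)) + 2 * b   ≡⟨ expand b h (suc n) ⟩
    b * suc n * (2 + (h + h)) + 2 * b   ≤⟨ +-monoˡ-≤ (2 * b) (*-monoʳ-≤ (b * suc n) (+-monoʳ-≤ 2 h+h≤b)) ⟩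
    b * suc n * (2 + b) + 2 * b         ≡⟨ expand′ n ⟩
    b ^ 3 + b ^ 2                       ∎
    where
    open ≤-Reasoning
    h : ℕ
    h = ⌊ b /2⌋
    h+h≤b : h + h ≤ b
    h+h≤b = ≤-trans (+-monoʳ-≤ h (⌊n/2⌋≤⌈n/2⌉ b)) (≤-reflexive (⌊n/2⌋+⌈n/2⌉≡n b))
    expand : ∀ b h m → 2 * (b * ((1 + h) * m)) + 2 * b ≡ b * m * (2 + (h + h)) + 2 * b
    expand = solve-∀
    expand′ : ∀ m → (2 + m) * (1 + m) * (2 + (2 + m)) + 2 * (2 + m) ≡ (2 + m) * ((2 + m) * ((2 + m) * 1)) + (2 + m) * ((2 + m) * 1)
    expand′ = solve-∀

theorem7 : (b k : ℕ) → .{{_ : NonZero b}} → 2 ≤ b → 1 ≤ k → IsOasis k b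
         → 2 * k + 2 * b ≤ b ^ 3 + b ^ 2
theorem7 (suc (suc n)) k _ 1≤k (c₀ , fps) =
  ≤-trans (+-monoˡ-≤ (2 * b n) (*-monoʳ-≤ 2 (Oasis.k≤codeSize n fps 1≤k))) (2*codeSize+2*b≤b³+b² n)
theorem7 1 k (s≤s ()) _ _
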